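{- There exist a graph $G$, a positive integer $m$, and an $m$-weighting $w$ of $G$ such that $\pi_3(G(w)) < \pi_3(G(w'))$ for every uniform-$\alpha$ $m$-weighting $w'$ of $G$.
   Context: All graphs are simple. $\mathbb{N}_0 = \{0,1,2,\dots\}$. For a graph $G$, a function $w: V(G) \to \mathbb{N}_0$ with $\sum_{v \in V(G)} w(v) = m$ is an $m$-weighting of $G$. $G(w)$ is the graph obtained from $G$ by replacing each vertex $v$ by a clique $K^v$ on $w(v)$ vertices and joining every vertex of $K^u$ to every vertex of $K^v$ whenever $uv \in E(G)$. $\pi_3(H)$ denotes the number of triangles ($3$-cliques) of a graph $H$. An $m$-weighting $w$ is uniform on $U \subseteq V(G)$ if $w(v)=0$ for all $v \notin U$ and $w(u) \in \{\lfloor m/|U|\rfloor, \lceil m/|U| \rceil\}$ for all $u \in U$; $w$ is uniform-$\alpha$ if it is uniform on some independent set of $G$ of maximum size. -}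

module Defs where

open import Data.Nat using (ℕ; zero; suc; _+_; _∸_; _≤_; _<ᵇ_; NonZero; _/_)
open import Data.Bool using (Bool; true; false; _∧_; _∨_)
open import Data.Fin using (Fin; toℕ; _≟_)
open import Data.Fin.Subset using (Subset; _∈_; _∉_; ∣_∣)
open import Data.List using (List; length; lookup; concatMap; replicate; map; filterᵇ; allFin)
open import Data.Nat.ListAction using (sum)
open import Relation.Nullary using (yes; no)
open import Data.Product using (_×_; _,_; Σ)
open import Data.Sum using (_⊎_)
open import Relation.Nullary.Decidable using (⌊_⌋)
open import Relation.Binary.PropositionalEquality using (_≡_)

record Graph : Set where
  field
    n     : ℕ
    adj   : Fin n → Fin n → Bool
    sym   : ∀ u v → adj u v ≡ adj v u
    irrefl : ∀ v → adj v v ≡ false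
open Graph public

triangleCount : (N : ℕ) → (Fin N → Fin N → Bool) → ℕ
triangleCount N a =
  length (filterᵇ isTri
    (concatMap (λ x → concatMap (λ y → map (λ z → x , y , z) (allFin N)) (allFin N)) (allFin N)))
  where
  isTri : Fin N × Fin N × Fin N → Bool
  isTri (x , y , z) =
    (toℕ x <ᵇ toℕ y) ∧ (toℕ y <ᵇ toℕ z) ∧ a x y ∧ a y z ∧ a x z

Weight : Graph → Set
Weight G = Fin (n G) → ℕ

total : (G : Graph) → Weight G → ℕ
total G w = sum (map w (allFin (n G)))

IsWeighting : (G : Graph) → ℕ → Weight G → Set
IsWeighting G m w = total G w ≡ m

-- Blow-up G(w): vertices are the positions of the list in which each vertex v
-- of G is repeated w(v) times (so vertex v is replaced by w(v) vertices,
-- the clique K^v); `cls` gives the original vertex of each new vertex.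
blocks : (G : Graph) → Weight G → List (Fin (n G))
blocks G w = concatMap (λ v → replicate (w v) v) (allFin (n G))

blowN : (G : Graph) → Weight G → ℕ
blowN G w = length (blocks G w)

cls : (G : Graph) (w : Weight G) → Fin (blowN G w) → Fin (n G)
cls G w = lookup (blocks G w)

blowAdj : (G : Graph) (w : Weight G) → Fin (blowN G w) → Fin (blowN G w) → Bool
blowAdj G w x y with x ≟ y
... | yes _ = false
... | no _ = ⌊ cls G w x ≟ cls G w y ⌋ ∨ adj G (cls G w x) (cls G w y)

π₃-blowup : (G : Graph) → Weight G → ℕ
π₃-blowup G w = triangleCount (blowN G w) (blowAdj G w)

Independent : (G : Graph) → Subset (n G) → Set
Independent G S = ∀ u v → u ∈ S → v ∈ S → adj G u v ≡ false

MaxIndependent : (G : Graph) → Subset (n G) → Set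
MaxIndependent G S = Independent G S × (∀ T → Independent G T → ∣ T ∣ ≤ ∣ S ∣)

⌈_/_⌉ : (m k : ℕ) .{{_ : NonZero k}} → ℕ
⌈ m / k ⌉ = (m + k ∸ 1) / k

-- w is uniform on U (as an m-weighting): zero outside U, and
-- each u ∈ U gets ⌊m/|U|⌋ or ⌈m/|U|⌉. (When U = ∅ the second clause is vacuous.)
UniformOn : (G : Graph) → ℕ → Weight G → Subset (n G) → Set
UniformOn G m w U =
  (∀ v → v ∉ U → w v ≡ 0) ×
  (∀ u → u ∈ U → (nz : NonZero ∣ U ∣) →
     (w u ≡ (_/_ m ∣ U ∣ {{nz}})) ⊎ (w u ≡ ⌈_/_⌉ m ∣ U ∣ {{nz}}))

UniformAlpha : (G : Graph) → ℕ → Weight G → Set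
UniformAlpha G m w = Σ (Subset (n G)) (λ U → MaxIndependent G U × UniformOn G m w U)

-- C₅ is triangle-free, so the all-ones 5-weighting has no triangles in its
-- blow-up.  An independent set of C₅ has at most two vertices, so by
-- pigeonhole a 5-weighting supported on one puts weight at least 3 on some
-- vertex, and the clique replacing that vertex already contains a triangle.
{-# OPTIONS --safe #-}
module Submission where

open import Defs
open import Data.Nat using (ℕ; _<_; NonZero)
open import Data.Product using (Σ; _×_)

open import Data.Bool using (Bool; T; _∧_; _∨_; false)
open import Data.Bool.Properties using (T-∧; T-∨; ∨-comm)
import Data.Bool.Properties as Bool
open import Data.Fin using (Fin; toℕ; zero; suc; _≟_)
open import Data.Fin.Properties using (any?; all?)
open import Data.Fin.Subset using (Subset; ∣_∣; _∉_; inside; outside)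
open import Data.Fin.Subset.Properties using (_∈?_; drop-there; anySubset?)
open import Data.List using (List; []; _∷_; _++_; length; lookup; concatMap; map; replicate; tabulate; allFin)
open import Data.List.Membership.Propositional using (_∈_)
open import Data.List.Membership.Propositional.Properties
  using (∈-allFin; ∈-concat⁺′; ∈-map⁺; ∈-filter⁺; ∈-∃++)
open import Data.List.Properties using (concatMap-++; map-tabulate)
open import Data.List.Relation.Unary.Any using (here; there)
open import Data.Nat using (_+_; _*_; _≤_; z≤n; s≤s; _<?_; _≡ᵇ_; _<ᵇ_; _%_)
open import Data.Nat.ListAction using (sum)
open import Data.Nat.Properties using (<⇒<ᵇ; <⇒≢; <-trans; +-mono-≤; *-monoˡ-≤; ≮⇒≥; <⇒≱)
open import Data.Product using (_,_; ∃; ∃₂)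
open import Data.Sum using (inj₁)
import Data.Vec as Vec
open import Function using (_∘_; id; Equivalence)
open import Relation.Binary.PropositionalEquality using (_≡_; refl; cong; trans; subst)
import Relation.Binary.PropositionalEquality as ≡
open import Relation.Nullary using (yes; no; contradiction)
open import Relation.Nullary.Decidable using (⌊_⌋; fromWitness; from-no; _×-dec_; _→-dec_)
open import Relation.Unary using (Decidable)

open Equivalence using (from)

∈-concatMap⁺′ : ∀ {A B : Set} {f : A → List B} {x xs y} → x ∈ xs → y ∈ f x → y ∈ concatMap f xs
∈-concatMap⁺′ x∈xs y∈fx = ∈-concat⁺′ y∈fx (∈-map⁺ _ x∈xs)

∈⇒length-pos : ∀ {A : Set} {x : A} {xs} → x ∈ xs → 0 < length xs
∈⇒length-pos (here _)  = s≤s z≤n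
∈⇒length-pos (there _) = s≤s z≤n

triangleCount-pos : ∀ {N} (a : Fin N → Fin N → Bool) {x y z : Fin N} →
                    toℕ x < toℕ y → toℕ y < toℕ z → T (a x y) → T (a y z) → T (a x z) →
                    0 < triangleCount N a
triangleCount-pos {N} a {x} {y} {z} x<y y<z xy yz xz =
  ∈⇒length-pos (∈-filter⁺ _ xyz∈triples xyz-isTriangle)
  where
  xyz∈triples : (x , y , z) ∈ concatMap (λ x → concatMap (λ y → map (λ z → x , y , z) (allFin N)) (allFin N)) (allFin N)
  xyz∈triples = ∈-concatMap⁺′ (∈-allFin x) (∈-concatMap⁺′ (∈-allFin y) (∈-map⁺ _ (∈-allFin z)))
  xyz-isTriangle : T ((toℕ x <ᵇ toℕ y) ∧ (toℕ y <ᵇ toℕ z) ∧ a x y ∧ a y z ∧ a x z)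
  xyz-isTriangle = from T-∧ (<⇒<ᵇ x<y , from T-∧ (<⇒<ᵇ y<z , from T-∧ (xy , from T-∧ (yz , xz))))

blowAdj-sameClique : ∀ G w {x y} → toℕ x < toℕ y → cls G w x ≡ cls G w y → T (blowAdj G w x y)
blowAdj-sameClique G w {x} {y} x<y same with x ≟ y
... | yes x≡y = contradiction (cong toℕ x≡y) (<⇒≢ x<y)
... | no _    = from (T-∨ {⌊ cls G w x ≟ cls G w y ⌋}) (inj₁ (fromWitness same))

record ThreeCopies {A : Set} (xs : List A) (v : A) : Set where
  field
    {p q r} : Fin (length xs)
    p<q     : toℕ p < toℕ q
    q<r     : toℕ q < toℕ r
    p↦v     : lookup xs p ≡ v
    q↦v     : lookup xs q ≡ v
    r↦v     : lookup xs r ≡ v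

threeCopies : ∀ {A : Set} (pre : List A) v post → ThreeCopies (pre ++ v ∷ v ∷ v ∷ post) v
threeCopies []        v post = record
  { p = zero ; q = suc zero ; r = suc (suc zero)
  ; p<q = s≤s z≤n ; q<r = s≤s (s≤s z≤n) ; p↦v = refl ; q↦v = refl ; r↦v = refl }
threeCopies (_ ∷ pre) v post = record
  { p<q = s≤s p<q ; q<r = s≤s q<r ; p↦v = p↦v ; q↦v = q↦v ; r↦v = r↦v }
  where open ThreeCopies (threeCopies pre v post)

threeCopies-replicate : ∀ {A : Set} (pre : List A) v {n} post → 2 < n →
                        ThreeCopies (pre ++ replicate n v ++ post) v
threeCopies-replicate pre v post (s≤s (s≤s (s≤s {n = k} _))) = threeCopies pre v (replicate k v ++ post)

concatMap-split : ∀ {A B : Set} (f : A → List B) {v xs} → v ∈ xs →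
                  ∃₂ λ pre post → concatMap f xs ≡ pre ++ f v ++ post
concatMap-split f v∈xs with ys , zs , refl ← ∈-∃++ v∈xs =
  concatMap f ys , concatMap f zs , concatMap-++ f ys (_ ∷ zs)

clique-triangle : ∀ G w v → 2 < w v → 0 < π₃-blowup G w
clique-triangle G w v 2<wv with pre , post , eq ← concatMap-split (λ u → replicate (w u) u) (∈-allFin v) =
  triangleCount-pos (blowAdj G w) p<q q<r
    (sameClique p<q p↦v q↦v) (sameClique q<r q↦v r↦v) (sameClique (<-trans p<q q<r) p↦v r↦v)
  where
  open ThreeCopies (subst (λ xs → ThreeCopies xs v) (≡.sym eq) (threeCopies-replicate pre v post 2<wv))
  sameClique : ∀ {x y} → toℕ x < toℕ y → cls G w x ≡ v → cls G w y ≡ v → T (blowAdj G w x y)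
  sameClique x<y x↦v y↦v = blowAdj-sameClique G w x<y (trans x↦v (≡.sym y↦v))

sum-supported≤ : ∀ {n} (U : Subset n) (w : Fin n → ℕ) {k} →
                 (∀ v → v ∉ U → w v ≡ 0) → (∀ v → w v ≤ k) → sum (tabulate w) ≤ ∣ U ∣ * k
sum-supported≤ Vec.[]            w off bound = z≤n
sum-supported≤ (outside Vec.∷ U) w off bound rewrite off zero (λ ()) =
  sum-supported≤ U (w ∘ suc) (λ v v∉U → off (suc v) (v∉U ∘ drop-there)) (bound ∘ suc)
sum-supported≤ (inside Vec.∷ U)  w off bound =
  +-mono-≤ (bound zero) (sum-supported≤ U (w ∘ suc) (λ v v∉U → off (suc v) (v∉U ∘ drop-there)) (bound ∘ suc))

total≡sum-tabulate : ∀ G (w : Weight G) → total G w ≡ sum (tabulate w)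
total≡sum-tabulate G w = cong sum (map-tabulate id w)

heavy-vertex : ∀ G {m} (w : Weight G) (U : Subset (n G)) {k} → IsWeighting G m w →
               (∀ v → v ∉ U → w v ≡ 0) → ∣ U ∣ * k < m → ∃ λ v → k < w v
heavy-vertex G w U {k} refl off |U|k<m with any? (λ v → k <? w v)
... | yes heavy = heavy
... | no light  = contradiction total≤ (<⇒≱ |U|k<m)
  where
  total≤ : total G w ≤ ∣ U ∣ * k
  total≤ rewrite total≡sum-tabulate G w = sum-supported≤ U w off (λ v → ≮⇒≥ (λ k<wv → light (v , k<wv)))

independent? : ∀ G → Decidable (Independent G)
independent? G S = all? λ u → all? λ v → (u ∈? S) →-dec ((v ∈? S) →-dec (adj G u v Bool.≟ false))

pentagonAdj : Fin 5 → Fin 5 → Bool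
pentagonAdj u v = ((1 + toℕ u) % 5 ≡ᵇ toℕ v) ∨ ((1 + toℕ v) % 5 ≡ᵇ toℕ u)

pentagon : Graph
pentagon = record
  { n      = 5
  ; adj    = pentagonAdj
  ; sym    = λ u v → ∨-comm ((1 + toℕ u) % 5 ≡ᵇ toℕ v) _
  ; irrefl = λ { zero → refl ; (suc zero) → refl ; (suc (suc zero)) → refl
               ; (suc (suc (suc zero))) → refl ; (suc (suc (suc (suc zero)))) → refl }
  }

pentagon-independent≤2 : ∀ S → Independent pentagon S → ∣ S ∣ ≤ 2
pentagon-independent≤2 S ind = ≮⇒≥ λ 2<∣S∣ →
  from-no (anySubset? (λ T → independent? pentagon T ×-dec 2 <? ∣ T ∣)) (S , ind , 2<∣S∣)

theorem8 : Σ Graph (λ G → Σ ℕ (λ m → NonZero m × Σ (Weight G) (λ w →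
             IsWeighting G m w ×
             (∀ (w' : Weight G) → IsWeighting G m w' → UniformAlpha G m w' →
                π₃-blowup G w < π₃-blowup G w'))))
theorem8 = pentagon , 5 , _ , (λ _ → 1) , refl , uniformα-has-triangle
  where
  uniformα-has-triangle : ∀ w' → IsWeighting pentagon 5 w' → UniformAlpha pentagon 5 w' → 0 < π₃-blowup pentagon w'
  uniformα-has-triangle w' w'-weighting (U , (U-independent , _) , (off-U , _)) =
    let v , 2<w'v = heavy-vertex pentagon w' U w'-weighting off-U ∣U∣*2<5
    in  clique-triangle pentagon w' v 2<w'v
    where
    ∣U∣*2<5 : ∣ U ∣ * 2 < 5
    ∣U∣*2<5 = s≤s (*-monoˡ-≤ 2 (pentagon-independent≤2 U U-independent))
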